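{- The graph $\Gamma_5$ is connected, in the sense that for any two vertices $x,y$ of $\Gamma_5$ there exists a directed path in $\Gamma_5$ from $x$ to $y$.
   Context: Define sets of positive integers $R_1,R_2,\dots$ recursively: $R_1=\{2\}$; for each $k\ge 1$, if $x\in R_k$ then $(x+5)^2\in R_{k+1}$; for each $k\ge1$, if $x^2\in R_k$ (with $x$ a positive integer) then $x\in R_{k+1}$. Let $S=\bigcup_{i\ge1}R_i$ (it is known that $S=\{n\ge 2: n\not\equiv 0 \pmod 5\}$). The directed graph $\Gamma_5$ has vertex set $S$ and two kinds of edges: up-edges $(n,(n+5)^2)$ for $n\in S$, and down-edges $(n^2,n)$ for $n\in S$ (with $n^2\in S$). -}

module Defs where

open import Data.Nat using (ℕ; suc; _+_; _*_)
open import Data.Product using (∃)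
open import Relation.Binary.PropositionalEquality using (_≡_)
open import Relation.Binary.Construct.Closure.ReflexiveTransitive using (Star)

-- R k n  means  n ∈ R_k  (k ≥ 1; index 0 is unused / empty)
data R : ℕ → ℕ → Set where
  base : R 1 2
  up   : ∀ {k x} → R k x → R (suc k) ((x + 5) * (x + 5))
  down : ∀ {k x} → R k (x * x) → R (suc k) x
-- note: x ranges over ℕ; x * x ∈ R_k forces x * x ≥ 2, hence x positive.

S : ℕ → Set
S n = ∃ λ k → R k n

data Edge : ℕ → ℕ → Set where
  upE   : ∀ {n} → S n → Edge n ((n + 5) * (n + 5))
  downE : ∀ {n} → S n → S (n * n) → Edge (n * n) n

Path : ℕ → ℕ → Set
Path = Star Edge

-- Every vertex reaches 2, and 2 reaches every vertex along the derivation witnessing its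
-- membership in S.  An up-edge followed by a down-edge is a step n → n + 5, so from n we can
-- reach any square a² ≡ n (mod 5) above n and then descend to a.  Vertices are units mod 5 and
-- units have fourth power 1, so two up-edges lead from any vertex to some 6 + 5q; since (6 + 5q)² ≡ 6 + 5(q + 1)
-- (mod 5), such a vertex descends step by step to 6, and 6 → 11 → 256 → 16 → 4 → 2.
module Submission where

open import Defs
open import Data.Nat using (ℕ; zero; suc; _+_; _*_; _<_; s≤s)
open import Data.Nat.Properties using (+-assoc; +-comm; +-identityʳ)
open import Data.Nat.DivMod using (_%_; _/_; %-distribˡ-*; [m+kn]%n≡m%n; m%n<n; m≡m%n+[m/n]*n)
open import Data.Product using (∃; _,_)
open import Data.Empty using (⊥-elim)
open import Relation.Binary.PropositionalEquality
  using (_≡_; _≢_; refl; sym; trans; cong; subst; module ≡-Reasoning)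
open import Relation.Binary.Construct.Closure.ReflexiveTransitive using (ε; _◅_; _◅◅_)
open import Data.Nat.Tactic.RingSolver using (solve-∀)

S-up : ∀ {n} → S n → S ((n + 5) * (n + 5))
S-up (k , d) = suc k , up d

S-down : ∀ {n} → S (n * n) → S n
S-down (k , d) = suc k , down d

Edge⇒S-target : ∀ {x y} → Edge x y → S y
Edge⇒S-target (upE s)     = S-up s
Edge⇒S-target (downE s _) = s

Path-preserves-S : ∀ {x y} → Path x y → S x → S y
Path-preserves-S ε       s = s
Path-preserves-S (e ◅ p) _ = Path-preserves-S p (Edge⇒S-target e)

upPath : ∀ {n} → S n → Path n ((n + 5) * (n + 5))
upPath s = upE s ◅ ε

downPath : ∀ {n} → S (n * n) → Path (n * n) n
downPath s = downE (S-down s) s ◅ ε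

R⇒Path-from-2 : ∀ {k n} → R k n → Path 2 n
R⇒Path-from-2 base     = ε
R⇒Path-from-2 (up d)   = R⇒Path-from-2 d ◅◅ upPath (_ , d)
R⇒Path-from-2 (down d) = R⇒Path-from-2 d ◅◅ downPath (_ , d)

path-+5 : ∀ {n} → S n → Path n (n + 5)
path-+5 s = upPath s ◅◅ downPath (S-up s)

path-+5* : ∀ j {n} → S n → Path n (n + j * 5)
path-+5* zero    {n} s rewrite +-identityʳ n = ε
path-+5* (suc j) {n} s rewrite sym (+-assoc n 5 (j * 5)) =
  path-+5 s ◅◅ path-+5* j (Path-preserves-S (path-+5 s) s)

path-to-root : ∀ {n} → S n → (a j : ℕ) → a * a ≡ n + j * 5 → Path n a
path-to-root {n} s a j a²≡n+5j =
  climb ◅◅ downPath (Path-preserves-S climb s)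
  where
    climb : Path n (a * a)
    climb = subst (Path n) (sym a²≡n+5j) (path-+5* j s)

square-6+5k : ∀ k → (6 + k * 5) * (6 + k * 5) ≡ (6 + suc k * 5) + (5 + 11 * k + 5 * (k * k)) * 5
square-6+5k = solve-∀

descend-to-6 : ∀ k → S (6 + k * 5) → Path (6 + k * 5) 6
descend-to-6 zero    _ = ε
descend-to-6 (suc k) s = step ◅◅ descend-to-6 k (Path-preserves-S step s)
  where
    step : Path (6 + suc k * 5) (6 + k * 5)
    step = path-to-root s (6 + k * 5) (5 + 11 * k + 5 * (k * k)) (square-6+5k k)

path-6-2 : S 6 → Path 6 2
path-6-2 s6 = path-+5 s6 ◅◅ upPath s11 ◅◅ root 16 s256 ◅◅ root 4 s16 ◅◅ root 2 s4
  where
    root : ∀ a → S (a * a) → Path (a * a) a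
    root a s = path-to-root s a 0 (sym (+-identityʳ (a * a)))
    s11 : S 11
    s11 = Path-preserves-S (path-+5 s6) s6
    s256 : S 256
    s256 = S-up s11
    s16 : S 16
    s16 = S-down s256
    s4 : S 4
    s4 = S-down s16

square-%5 : ∀ x → (x * x) % 5 ≡ ((x % 5) * (x % 5)) % 5
square-%5 x = %-distribˡ-* x x 5

square-+5-%5 : ∀ x → ((x + 5) * (x + 5)) % 5 ≡ ((x % 5) * (x % 5)) % 5
square-+5-%5 x = trans (square-%5 (x + 5)) (cong (λ t → (t * t) % 5) ([m+kn]%n≡m%n x 1 5))

unit-square-%5 : ∀ r → r < 5 → r ≢ 0 → (r * r) % 5 ≢ 0
unit-square-%5 0 _ r≢0 = r≢0
unit-square-%5 1 _ _ ()
unit-square-%5 2 _ _ ()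
unit-square-%5 3 _ _ ()
unit-square-%5 4 _ _ ()
unit-square-%5 (suc (suc (suc (suc (suc _))))) (s≤s (s≤s (s≤s (s≤s (s≤s ()))))) _

unit-fourth-power-%5 : ∀ r → r < 5 → r ≢ 0 → (((r * r) % 5) * ((r * r) % 5)) % 5 ≡ 1
unit-fourth-power-%5 0 _ r≢0 = ⊥-elim (r≢0 refl)
unit-fourth-power-%5 1 _ _ = refl
unit-fourth-power-%5 2 _ _ = refl
unit-fourth-power-%5 3 _ _ = refl
unit-fourth-power-%5 4 _ _ = refl
unit-fourth-power-%5 (suc (suc (suc (suc (suc _))))) (s≤s (s≤s (s≤s (s≤s (s≤s ()))))) _

R⇒%5≢0 : ∀ {k n} → R k n → n % 5 ≢ 0
R⇒%5≢0 base ()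
R⇒%5≢0 (up {x = x} d) x'≡0 =
  unit-square-%5 (x % 5) (m%n<n x 5) (R⇒%5≢0 d) (trans (sym (square-+5-%5 x)) x'≡0)
R⇒%5≢0 (down {x = x} d) x≡0 =
  R⇒%5≢0 d (trans (square-%5 x) (cong (λ t → (t * t) % 5) x≡0))

S⇒%5≢0 : ∀ {n} → S n → n % 5 ≢ 0
S⇒%5≢0 (_ , d) = R⇒%5≢0 d

twice-up-%5 : ∀ {n} → S n → let y = (n + 5) * (n + 5) in ((y + 5) * (y + 5)) % 5 ≡ 1
twice-up-%5 {n} s = begin
  ((y + 5) * (y + 5)) % 5  ≡⟨ square-+5-%5 y ⟩
  ((y % 5) * (y % 5)) % 5  ≡⟨ cong (λ t → (t * t) % 5) (square-+5-%5 n) ⟩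
  (r² * r²) % 5            ≡⟨ unit-fourth-power-%5 (n % 5) (m%n<n n 5) (S⇒%5≢0 s) ⟩
  1                        ∎
  where
    open ≡-Reasoning
    y = (n + 5) * (n + 5)
    r² = ((n % 5) * (n % 5)) % 5

square-+5≢1 : ∀ y → (y + 5) * (y + 5) ≢ 1
square-+5≢1 y rewrite +-comm y 5 = λ ()

%5≡1⇒6+5q : ∀ n → n % 5 ≡ 1 → n ≢ 1 → ∃ λ q → n ≡ 6 + q * 5
%5≡1⇒6+5q n n%5≡1 n≢1 with n / 5 | trans (m≡m%n+[m/n]*n n 5) (cong (_+ (n / 5) * 5) n%5≡1)
... | zero  | n≡1    = ⊥-elim (n≢1 n≡1)
... | suc q | n≡6+5q = q , n≡6+5q

path-from-1-mod-5 : ∀ {z} → S z → z % 5 ≡ 1 → z ≢ 1 → Path z 2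
path-from-1-mod-5 {z} s z%5≡1 z≢1 with %5≡1⇒6+5q z z%5≡1 z≢1
... | q , refl = descend-to-6 q s ◅◅ path-6-2 (Path-preserves-S (descend-to-6 q s) s)

path-to-2 : ∀ {n} → S n → Path n 2
path-to-2 {n} s = upPath s ◅◅ upPath (S-up s) ◅◅
  path-from-1-mod-5 (S-up (S-up s)) (twice-up-%5 s) (square-+5≢1 ((n + 5) * (n + 5)))

theorem5 : (x y : ℕ) → S x → S y → Path x y
theorem5 x y sx (_ , d) = path-to-2 sx ◅◅ R⇒Path-from-2 d
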